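{- Let $G$ be a ribbon graph with $|E(G)|=m$, let $E_1,E_2\subseteq E(G)$ and let $k$ be a positive integer. If $G^{\delta(E_1)}$ is a bouquet and $G^{\delta(E_1)\delta(E_2)}$ is $k$-regular, then, with $n=\frac{2m}{k}-1$, we have $|E_2|\geq n$.
   Context: A ribbon graph is a surface with boundary written as a union of vertex discs and edge discs meeting in disjoint line segments (each edge meets vertices in exactly two such segments); the degree of a vertex is the number of such segments on it, and $k$-regular means all vertices have degree $k$. A bouquet is a ribbon graph with exactly one vertex. Arrow presentation: circles (vertex boundaries) with, for each edge $e$, two marking arrows labelled $e$; the ribbon graph is recovered by filling the circles with discs and attaching an edge disc along the two $e$-arrows so that their directions agree. Partial dual $G^{\delta(A)}$: for each $e\in A$ with arrows $e',e''$, draw segments directed from the head of $e'$ to the tail of $e''$ and from the head of $e''$ to the tail of $e'$, both labelled $e$, and delete the arcs carrying $e',e''$. Edges are identified across partial duals, and $G^{\delta(E_1)\delta(E_2)}$ means $(G^{\delta(E_1)})^{\delta(E_2)}$. -}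

module Defs where

open import Data.Nat using (ℕ; zero; suc; _*_)
open import Data.Fin using (Fin; zero; suc)
open import Data.Fin.Subset using (Subset; _∈_)
open import Data.Fin.Subset.Properties using (_∈?_)
open import Data.Product using (_×_; _,_; ∃)
open import Data.Sum using (_⊎_)
open import Data.Empty using (⊥-elim)
open import Data.List using (List; length)
import Data.List.Membership.Propositional as LM
open import Data.List.Relation.Unary.Unique.Propositional using (Unique)
open import Relation.Nullary using (¬_; yes; no)
open import Relation.Binary.PropositionalEquality using (_≡_; _≢_; refl; cong; sym; trans)
open import Relation.Binary.Construct.Closure.ReflexiveTransitive using (Star)
open import Function.Bundles using (_⇔_)

-- Each edge e of a ribbon graph with m edges carries two marking arrows
-- e' and e''.  Their four endpoints are the "points" (e , i) with
--   i = 0 : tail of e' ,  i = 1 : head of e' ,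
--   i = 2 : tail of e'',  i = 3 : head of e''.
-- The arcs of the vertex circles that lie between arrows are recorded by a
-- fixed-point-free involution σ on points (σ p = the point reached from p
-- by following the circle away from p's arrow).  Circles carrying no arrow
-- (isolated vertices) are counted separately by `isolated`.

Point : ℕ → Set
Point m = Fin m × Fin 4

arrowMate : Fin 4 → Fin 4
arrowMate zero = suc zero
arrowMate (suc zero) = zero
arrowMate (suc (suc zero)) = suc (suc (suc zero))
arrowMate (suc (suc (suc zero))) = suc (suc zero)

α : ∀ {m} → Point m → Point m
α (e , i) = e , arrowMate i

record RibbonGraph : Set where
  field
    m        : ℕ
    isolated : ℕ
    σ        : Point m → Point m
    σ-invol  : ∀ p → σ (σ p) ≡ p
    σ-nofix  : ∀ p → σ p ≢ p
open RibbonGraph public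

data Step {m} (s : Point m → Point m) : Point m → Point m → Set where
  viaArrow : ∀ p → Step s p (α p)
  viaArc   : ∀ p → Step s p (s p)

SameVertex : (G : RibbonGraph) → Point (m G) → Point (m G) → Set
SameVertex G = Star (Step (σ G))

-- The vertex (circle) through point p carries exactly d marking arrows,
-- i.e. exactly 2d arrow endpoints: its degree is d.
DegreeAt : (G : RibbonGraph) → Point (m G) → ℕ → Set
DegreeAt G p d =
  ∃ λ (xs : List (Point (m G))) →
    Unique xs × length xs ≡ 2 * d × (∀ q → (q LM.∈ xs) ⇔ SameVertex G p q)

IsBouquet : RibbonGraph → Set
IsBouquet G =
    (isolated G ≡ 1 × m G ≡ 0)
  ⊎ (isolated G ≡ 0 × ¬ (m G ≡ 0) × (∀ p q → SameVertex G p q))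

IsRegular : ℕ → RibbonGraph → Set
IsRegular k G = (¬ (isolated G ≡ 0) → k ≡ 0) × (∀ p → DegreeAt G p k)

-- After dualising e the new
-- arrows are: new e' from (old head of e') to (old tail of e''), and new e''
-- from (old head of e'') to (old tail of e').  So new label i corresponds to
-- old label rot i.
rot : Fin 4 → Fin 4
rot zero = suc zero
rot (suc zero) = suc (suc zero)
rot (suc (suc zero)) = suc (suc (suc zero))
rot (suc (suc (suc zero))) = zero

rot⁻ : Fin 4 → Fin 4
rot⁻ zero = suc (suc (suc zero))
rot⁻ (suc zero) = zero
rot⁻ (suc (suc zero)) = suc zero
rot⁻ (suc (suc (suc zero))) = suc (suc zero)

rot⁻-rot : ∀ i → rot⁻ (rot i) ≡ i
rot⁻-rot zero = refl
rot⁻-rot (suc zero) = refl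
rot⁻-rot (suc (suc zero)) = refl
rot⁻-rot (suc (suc (suc zero))) = refl

rot-rot⁻ : ∀ i → rot (rot⁻ i) ≡ i
rot-rot⁻ zero = refl
rot-rot⁻ (suc zero) = refl
rot-rot⁻ (suc (suc zero)) = refl
rot-rot⁻ (suc (suc (suc zero))) = refl

module _ {m : ℕ} (A : Subset m) where
  ρ : Point m → Point m
  ρ (e , i) with e ∈? A
  ... | yes _ = e , rot i
  ... | no _  = e , i

  ρ⁻ : Point m → Point m
  ρ⁻ (e , i) with e ∈? A
  ... | yes _ = e , rot⁻ i
  ... | no _  = e , i

  ρ⁻-ρ : ∀ p → ρ⁻ (ρ p) ≡ p
  ρ⁻-ρ (e , i) with e ∈? A
  ... | yes a with e ∈? A
  ...   | yes _ = cong (e ,_) (rot⁻-rot i)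
  ...   | no ¬a = ⊥-elim (¬a a)
  ρ⁻-ρ (e , i) | no ¬a with e ∈? A
  ...   | yes a = ⊥-elim (¬a a)
  ...   | no _  = refl

  ρ-ρ⁻ : ∀ p → ρ (ρ⁻ p) ≡ p
  ρ-ρ⁻ (e , i) with e ∈? A
  ... | yes a with e ∈? A
  ...   | yes _ = cong (e ,_) (rot-rot⁻ i)
  ...   | no ¬a = ⊥-elim (¬a a)
  ρ-ρ⁻ (e , i) | no ¬a with e ∈? A
  ...   | yes a = ⊥-elim (¬a a)
  ...   | no _  = refl

partialDual : (G : RibbonGraph) → Subset (m G) → RibbonGraph
partialDual G A = record
  { m        = m G
  ; isolated = isolated G
  ; σ        = σ'
  ; σ-invol  = inv
  ; σ-nofix  = nofix
  }
  where
  σ' : Point (m G) → Point (m G)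
  σ' p = ρ⁻ A (σ G (ρ A p))
  inv : ∀ p → σ' (σ' p) ≡ p
  inv p rewrite ρ-ρ⁻ A (σ G (ρ A p)) | σ-invol G (ρ A p) = ρ⁻-ρ A p
  nofix : ∀ p → σ' p ≢ p
  nofix p eq = σ-nofix G (ρ A p) help
    where
    help : σ G (ρ A p) ≡ ρ A p
    help = trans (sym (ρ-ρ⁻ A (σ G (ρ A p)))) (cong (ρ A) eq)

syntax partialDual G A = G ^δ A

-- Partial duality at a single edge e splits or merges vertices only along the
-- arrows of e, whose four endpoints lie on at most two vertex circles of the
-- dual; so dualising one more edge adds at most one vertex.  Starting from a
-- bouquet, G^{δ(E₁)δ(E₂)} therefore has at most |E₂| + 1 vertices.  Each has
-- degree k, i.e. carries 2k of the 4m arrow endpoints, so 4m ≤ (|E₂| + 1)·2k,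
-- which with 2m = (n + 1)k gives n ≤ |E₂|.
module Submission where

open import Defs
open import Data.Nat using (ℕ; zero; suc; _*_; _+_; _≤_; NonZero)
open import Data.Nat.Properties
  using (≤-refl; ≤-pred; <-≤-trans; n≮0; n≢0⇒n>0; 1+n≢0; +-comm
        ; m*n≡0⇒m≡0; *-cancelˡ-≤; *-cancelʳ-≤; module ≤-Reasoning)
open import Data.Nat.Tactic.RingSolver using (solve-∀)
open import Data.Fin using (Fin; zero; suc; _≟_; cast; fromℕ<)
open import Data.Fin.Patterns using (0F; 1F; 2F; 3F)
open import Data.Fin.Properties using (*↔×; injective⇒≤; cast-involutive)
open import Data.Fin.Subset using (Subset; ∣_∣; _∈_; _∉_; _─_; _-_; ⁅_⁆; Empty)
open import Data.Fin.Subset.Properties using (_∈?_; nonempty?; x∈p∧x≢y⇒x∈p-y; x∈p⇒∣p-x∣<∣p∣; p─q⊆p; x∈⁅x⁆)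
open import Data.Vec using (_∷_; here; there)
open import Data.List using (List; length; lookup)
open import Data.List.Membership.Propositional using () renaming (_∈_ to _∈ₗ_)
open import Data.List.Relation.Unary.Any using (index)
open import Data.List.Relation.Unary.Any.Properties using (lookup-index)
open import Data.Product using (_×_; _,_; ∃; Σ; proj₁; proj₂)
open import Data.Sum using (_⊎_; inj₁; inj₂; [_,_]′; swap)
open import Data.Empty using (⊥-elim)
open import Function using (_∘_; id)
open import Function.Bundles using (_↣_; mk↣; Injection; Equivalence)
open import Function.Definitions using (Injective)
open import Function.Construct.Composition using (_↣-∘_)
open import Function.Properties.Inverse using (↔⇒↣)
open import Function.Construct.Symmetry using (↔-sym)
open import Relation.Nullary using (yes; no)
open import Level using (0ℓ)
open import Relation.Binary.Core using (Rel; _⇒_)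
open import Relation.Binary.Definitions using (Symmetric)
open import Relation.Binary.PropositionalEquality
  using (_≡_; _≢_; refl; sym; trans; cong; module ≡-Reasoning)
open import Relation.Binary.Construct.Closure.ReflexiveTransitive
  using (Star; ε; _◅_; _◅◅_; reverse)
  renaming (map to Star-map)

Covering : {X : Set} → Rel X 0ℓ → ℕ → Set
Covering {X} T n = Σ (Fin n → X) λ rep → ∀ x → ∃ λ j → Star T (rep j) x

module OneMoreComponent
  {X : Set} {S T : Rel X 0ℓ} (S-sym : Symmetric S) (T-sym : Symmetric T) (a b : X)
  (simulate : ∀ {p q} → S p q → Star T p q ⊎ Star T a q ⊎ Star T b q) where

  simulate* : ∀ {p q} → Star S p q → Star T p q ⊎ Star T a q ⊎ Star T b q
  simulate* ε = inj₁ ε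
  simulate* (step ◅ path) with simulate* path
  ... | inj₂ near = inj₂ near
  ... | inj₁ path′ with simulate step
  ...   | inj₁ path″ = inj₁ (path″ ◅◅ path′)
  ...   | inj₂ (inj₁ a↝) = inj₂ (inj₁ (a↝ ◅◅ path′))
  ...   | inj₂ (inj₂ b↝) = inj₂ (inj₂ (b↝ ◅◅ path′))

  adjoin : ∀ {n} ((rep , _) : Covering S n) {j₀} c d → Star T c (rep j₀) →
           (∀ {q} → Star T a q ⊎ Star T b q → Star T c q ⊎ Star T d q) → Covering T (suc n)
  adjoin {n} (rep , covers) {j₀} c d c↝rep₀ sort = rep′ , covers′
    where
    rep′ : Fin (suc n) → X
    rep′ zero = d
    rep′ (suc j) = rep j
    covers′ : ∀ q → ∃ λ j → Star T (rep′ j) q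
    covers′ q with covers q
    ... | j , rep↝q with simulate* rep↝q
    ...   | inj₁ path = suc j , path
    ...   | inj₂ near with sort near
    ...     | inj₁ c↝q = suc j₀ , reverse T-sym c↝rep₀ ◅◅ c↝q
    ...     | inj₂ d↝q = zero , d↝q

  -- The representative reaching a is already T-joined to a or to b; adjoin the other one.
  covering-suc : ∀ {n} → Covering S n → Covering T (suc n)
  covering-suc cov@(_ , covers) with covers a
  ... | j₀ , rep₀↝a with [ inj₁ , id ]′ (simulate* (reverse S-sym rep₀↝a))
  ...   | inj₁ a↝rep₀ = adjoin cov a b a↝rep₀ id
  ...   | inj₂ b↝rep₀ = adjoin cov b a b↝rep₀ swap

α-involutive : ∀ {m} (p : Point m) → α (α p) ≡ p
α-involutive (_ , 0F) = refl
α-involutive (_ , 1F) = refl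
α-involutive (_ , 2F) = refl
α-involutive (_ , 3F) = refl

module _ {m} {s : Point m → Point m} where

  arrowTo : ∀ {p q} → α p ≡ q → Step s p q
  arrowTo refl = viaArrow _

  arcTo : ∀ {p q} → s p ≡ q → Step s p q
  arcTo refl = viaArc _

  step-sym : (∀ p → s (s p) ≡ p) → Symmetric (Step s)
  step-sym _   (viaArrow p) = arrowTo (α-involutive p)
  step-sym inv (viaArc p)   = arcTo (inv p)

  step-cong : ∀ {t} → (∀ p → s p ≡ t p) → Step t ⇒ Step s
  step-cong _  (viaArrow p) = viaArrow p
  step-cong eq (viaArc p)   = arcTo (eq p)

-- t is s with the arcs at the endpoints of e reattached as partial duality at e does;
-- an arc from endpoint i of e to another edge now leaves endpoint rot⁻ i.
module EdgeChange {m} {s t : Point m → Point m} (e : Fin m)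
  (agree : ∀ {p} → proj₁ p ≢ e → proj₁ (s p) ≢ e → t p ≡ s p)
  (turn : ∀ {i} → proj₁ (s (e , i)) ≢ e → t (e , rot⁻ i) ≡ s (e , i)) where

  Near : Point m → Set
  Near q = Star (Step t) (e , 0F) q ⊎ Star (Step t) (e , 2F) q

  near-extend : ∀ {p q} → Near p → Star (Step t) p q → Near q
  near-extend (inj₁ path) path′ = inj₁ (path ◅◅ path′)
  near-extend (inj₂ path) path′ = inj₂ (path ◅◅ path′)

  near-edge : ∀ i → Near (e , i)
  near-edge 0F = inj₁ ε
  near-edge 1F = inj₁ (viaArrow _ ◅ ε)
  near-edge 2F = inj₂ ε
  near-edge 3F = inj₂ (viaArrow _ ◅ ε)

  near-on : ∀ {q} → proj₁ q ≡ e → Near q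
  near-on {_ , i} refl = near-edge i

  simulate : ∀ {p q} → Step s p q → Star (Step t) p q ⊎ Near q
  simulate (viaArrow p) = inj₁ (viaArrow p ◅ ε)
  simulate (viaArc (f , i)) with proj₁ (s (f , i)) ≟ e | f ≟ e
  ... | yes sp∈e | _        = inj₂ (near-on sp∈e)
  ... | no sp∉e  | no f≢e   = inj₁ (arcTo (agree f≢e sp∉e) ◅ ε)
  ... | no sp∉e  | yes refl = inj₂ (near-extend (near-edge (rot⁻ i)) (arcTo (turn sp∉e) ◅ ε))

  covering-suc : (∀ p → s (s p) ≡ p) → (∀ p → t (t p) ≡ p) →
                 ∀ {n} → Covering (Step s) n → Covering (Step t) (suc n)
  covering-suc s-inv t-inv =
    OneMoreComponent.covering-suc (step-sym s-inv) (step-sym t-inv) (e , 0F) (e , 2F) simulate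

module _ {m} {A : Subset m} where

  ρ-in : ∀ {e i} → e ∈ A → ρ A (e , i) ≡ (e , rot i)
  ρ-in {e} e∈A with e ∈? A
  ... | yes _   = refl
  ... | no e∉A = ⊥-elim (e∉A e∈A)

  ρ-out : ∀ {p} → proj₁ p ∉ A → ρ A p ≡ p
  ρ-out {e , _} e∉A with e ∈? A
  ... | yes e∈A = ⊥-elim (e∉A e∈A)
  ... | no _    = refl

  ρ⁻-out : ∀ {p} → proj₁ p ∉ A → ρ⁻ A p ≡ p
  ρ⁻-out {e , _} e∉A with e ∈? A
  ... | yes e∈A = ⊥-elim (e∉A e∈A)
  ... | no _    = refl

  ρ⁻-edge : ∀ p → proj₁ (ρ⁻ A p) ≡ proj₁ p
  ρ⁻-edge (e , _) with e ∈? A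
  ... | yes _ = refl
  ... | no _  = refl

  module _ {B : Subset m} {p : Point m}
           (A⊆B : proj₁ p ∈ A → proj₁ p ∈ B) (B⊆A : proj₁ p ∈ B → proj₁ p ∈ A) where

    ρ-cong : ρ A p ≡ ρ B p
    ρ-cong with proj₁ p ∈? A | proj₁ p ∈? B
    ... | yes _   | yes _   = refl
    ... | no _    | no _    = refl
    ... | yes e∈A | no e∉B = ⊥-elim (e∉B (A⊆B e∈A))
    ... | no e∉A  | yes e∈B = ⊥-elim (e∉A (B⊆A e∈B))

    ρ⁻-cong : ρ⁻ A p ≡ ρ⁻ B p
    ρ⁻-cong with proj₁ p ∈? A | proj₁ p ∈? B
    ... | yes _   | yes _   = refl
    ... | no _    | no _    = refl
    ... | yes e∈A | no e∉B = ⊥-elim (e∉B (A⊆B e∈A))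
    ... | no e∉A  | yes e∈B = ⊥-elim (e∉A (B⊆A e∈B))

x∈q⇒x∉p─q : ∀ {n} {p q : Subset n} {x} → x ∈ q → x ∉ p ─ q
x∈q⇒x∉p─q {p = _ ∷ _} here        ()
x∈q⇒x∉p─q {p = _ ∷ _} (there x∈q) (there x∈p─q) = x∈q⇒x∉p─q x∈q x∈p─q

module RemoveEdge (H : RibbonGraph) {B : Subset (m H)} {e} (e∈B : e ∈ B) where

  private
    A : Subset (m H)
    A = B - e

    s t : Point (m H) → Point (m H)
    s = σ (H ^δ A)
    t = σ (H ^δ B)

    A⊆B : ∀ {f} → f ∈ A → f ∈ B
    A⊆B = p─q⊆p B ⁅ e ⁆

    B⊆A : ∀ {f} → f ≢ e → f ∈ B → f ∈ A
    B⊆A f≢e f∈B = x∈p∧x≢y⇒x∈p-y f∈B f≢e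

    arc-transfer : ∀ {p p′} → ρ B p ≡ ρ A p′ → proj₁ (s p′) ≢ e → t p ≡ s p′
    arc-transfer {p} {p′} ρp≡ρp′ sp′∉e = begin
      ρ⁻ B (σ H (ρ B p)) ≡⟨ cong (ρ⁻ B ∘ σ H) ρp≡ρp′ ⟩
      ρ⁻ B y             ≡⟨ ρ⁻-cong (B⊆A y∉e) A⊆B ⟩
      ρ⁻ A y             ∎
      where
      open ≡-Reasoning
      y : Point (m H)
      y = σ H (ρ A p′)
      y∉e : proj₁ y ≢ e
      y∉e eq = sp′∉e (trans (ρ⁻-edge y) eq)

    agree : ∀ {p} → proj₁ p ≢ e → proj₁ (s p) ≢ e → t p ≡ s p
    agree p∉e = arc-transfer (ρ-cong (B⊆A p∉e) A⊆B)

    turn : ∀ {i} → proj₁ (s (e , i)) ≢ e → t (e , rot⁻ i) ≡ s (e , i)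
    turn {i} = arc-transfer (begin
      ρ B (e , rot⁻ i)   ≡⟨ ρ-in e∈B ⟩
      (e , rot (rot⁻ i)) ≡⟨ cong (e ,_) (rot-rot⁻ i) ⟩
      (e , i)            ≡⟨ ρ-out (x∈q⇒x∉p─q (x∈⁅x⁆ e)) ⟨
      ρ A (e , i)        ∎)
      where open ≡-Reasoning

  covering-suc : ∀ {n} → Covering (Step (σ (H ^δ (B - e)))) n → Covering (Step (σ (H ^δ B))) (suc n)
  covering-suc = EdgeChange.covering-suc e agree turn (σ-invol (H ^δ A)) (σ-invol (H ^δ B))

σ-dual-empty : ∀ H {B : Subset (m H)} → Empty B → ∀ p → σ (H ^δ B) p ≡ σ H p
σ-dual-empty H {B} empty p = trans (cong (ρ⁻ B ∘ σ H) (ρ-out (∉B _))) (ρ⁻-out (∉B _))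
  where
  ∉B : ∀ f → f ∉ B
  ∉B f f∈B = empty (f , f∈B)

module _ (H : RibbonGraph) (p₀ : Point (m H)) (connected : ∀ p q → SameVertex H p q) where

  dual-covering : ∀ c (B : Subset (m H)) → ∣ B ∣ ≤ c → Covering (Step (σ (H ^δ B))) (suc c)
  dual-covering c B ∣B∣≤c with nonempty? B
  ... | no empty =
    (λ _ → p₀) , λ q → zero , Star-map (step-cong (σ-dual-empty H empty)) (connected p₀ q)
  dual-covering zero B ∣B∣≤0 | yes (e , e∈B) =
    ⊥-elim (n≮0 (<-≤-trans (x∈p⇒∣p-x∣<∣p∣ e∈B) ∣B∣≤0))
  dual-covering (suc c) B ∣B∣≤1+c | yes (e , e∈B) =
    RemoveEdge.covering-suc H e∈B
      (dual-covering c (B - e) (≤-pred (<-≤-trans (x∈p⇒∣p-x∣<∣p∣ e∈B) ∣B∣≤1+c)))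

product-injection-≤ : ∀ {a b c d} → (Fin a × Fin b) ↣ (Fin c × Fin d) → a * b ≤ c * d
product-injection-≤ f =
  injective⇒≤ (Injection.injective (↔⇒↣ (↔-sym *↔×) ↣-∘ (f ↣-∘ ↔⇒↣ *↔×)))

module _ (K : RibbonGraph) {k : ℕ} (regular : ∀ p → DegreeAt K p k) where

  covering-bound : ∀ {c} → Covering (Step (σ K)) c → m K * 4 ≤ c * (2 * k)
  covering-bound {c} (rep , covers) = product-injection-≤ (mk↣ encode-injective)
    where
    vertex : Fin c → List (Point (m K))
    vertex j = proj₁ (regular (rep j))

    length-vertex : ∀ j → length (vertex j) ≡ 2 * k
    length-vertex j = proj₁ (proj₂ (proj₂ (regular (rep j))))

    ∈-vertex : ∀ {j q} → SameVertex K (rep j) q → q ∈ₗ vertex j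
    ∈-vertex {j} {q} = Equivalence.from (proj₂ (proj₂ (proj₂ (regular (rep j)))) q)

    position : ∀ {j q} → SameVertex K (rep j) q → Fin (2 * k)
    position {j} path = cast (length-vertex j) (index (∈-vertex path))

    entry : Fin c × Fin (2 * k) → Point (m K)
    entry (j , i) = lookup (vertex j) (cast (sym (length-vertex j)) i)

    entry-position : ∀ {j q} (path : SameVertex K (rep j) q) → entry (j , position path) ≡ q
    entry-position {j} path = trans
      (cong (lookup (vertex j)) (cast-involutive (sym (length-vertex j)) (length-vertex j) _))
      (sym (lookup-index (∈-vertex path)))

    encode : Point (m K) → Fin c × Fin (2 * k)
    encode q = proj₁ (covers q) , position (proj₂ (covers q))

    encode-injective : Injective _≡_ _≡_ encode
    encode-injective eq =
      trans (sym (entry-position _)) (trans (cong entry eq) (entry-position _))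

double-count-bound : ∀ n k c M .{{_ : NonZero k}} →
                     (n + 1) * k ≡ 2 * M → M * 4 ≤ suc c * (2 * k) → n ≤ c
double-count-bound n k c M eq bound = ≤-pred (begin
  suc n   ≡⟨ +-comm 1 n ⟩
  n + 1   ≤⟨ *-cancelʳ-≤ (n + 1) (suc c) k (*-cancelˡ-≤ 2 (begin
    2 * ((n + 1) * k) ≡⟨ cong (2 *_) eq ⟩
    2 * (2 * M)       ≡⟨ 2*2*M≡M*4 M ⟩
    M * 4             ≤⟨ bound ⟩
    suc c * (2 * k)   ≡⟨ 1+c*2k≡2*1+c*k c k ⟩
    2 * (suc c * k)   ∎)) ⟩
  suc c   ∎)
  where
  open ≤-Reasoning
  2*2*M≡M*4 : ∀ M → 2 * (2 * M) ≡ M * 4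
  2*2*M≡M*4 = solve-∀
  1+c*2k≡2*1+c*k : ∀ c k → suc c * (2 * k) ≡ 2 * (suc c * k)
  1+c*2k≡2*1+c*k = solve-∀

lemma3p2 : (G : RibbonGraph) (E₁ E₂ : Subset (m G)) (k : ℕ) → NonZero k →
    IsBouquet (partialDual G E₁) →
    IsRegular k (partialDual (partialDual G E₁) E₂) →
    (n : ℕ) → (n + 1) * k ≡ 2 * m G →
    n ≤ ∣ E₂ ∣
lemma3p2 G E₁ E₂ k k≢0 (inj₁ (_ , m≡0)) _ n eq =
  ⊥-elim (1+n≢0 (trans (+-comm 1 n) (m*n≡0⇒m≡0 (n + 1) k {{k≢0}} (trans eq (cong (2 *_) m≡0)))))
lemma3p2 G E₁ E₂ k k≢0 (inj₂ (_ , m≢0 , connected)) (_ , regular) n eq =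
  double-count-bound n k ∣ E₂ ∣ (m G) {{k≢0}} eq
    (covering-bound (H ^δ E₂) {k} regular (dual-covering H p₀ connected ∣ E₂ ∣ E₂ ≤-refl))
  where
  H : RibbonGraph
  H = G ^δ E₁
  p₀ : Point (m G)
  p₀ = fromℕ< (n≢0⇒n>0 m≢0) , 0F
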